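{- Let $H$ be a maximal plane graph and $f$ a face of $H$ whose boundary vertices are labelled $x,y,z$, and let $k$ be an integer. If both $(k+1)_x^{y,z}$ and $(k+1)_y^{x,z}$ are nonempty, then $(k)_{s,t}$ is empty for every pair of distinct vertices $s,t\in\{x,y,z\}$. Furthermore, if in addition $q(H[f])=k$, then $(k)_z^{x,y}$ is nonempty.
   Context: $H$ is a maximal plane graph (every face bounded by a triangle); $d$ is shortest-path distance in $H$. $\mathrm{qcc}_H(S)=\{u\in V(H): \forall v\in V(H)\ \exists s\in S \text{ with } d(u,s)\geq d(v,s)\}$, and $Q:=\mathrm{qcc}_H(\{x,y,z\})$. The quasi-eccentricity is $q(H[f])=\min\{d(a,b):a\in\{x,y,z\},b\in Q\}$. For an integer $k$ and disjoint $A,B\subseteq\{x,y,z\}$, $(k)_A^B$ denotes the set of $u\in Q$ with $\min_{t\in\{x,y,z\}}d(u,t)=k$, $d(u,t)=k$ for all $t\in A$ and $d(u,t)=k+1$ for all $t\in B$ (an empty $A$ or $B$ is omitted; lists are written as sub/superscripts). -}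

module Defs where

open import Data.Bool using (Bool; true; false; T; _∧_; _∨_; if_then_else_)
open import Data.Nat using (ℕ; zero; suc; _+_; _*_; _≤_; _⊓_; _<ᵇ_)
open import Data.Fin using (Fin; toℕ; _≟_)
open import Data.List using (List; []; _∷_; map; allFin)
open import Data.Bool.ListAction using (any)
open import Data.Nat.ListAction using (sum)
open import Data.List.Relation.Unary.All using (All)
open import Data.Integer using (ℤ; +_)
open import Data.Product using (Σ; ∃; _×_; _,_)
open import Data.Sum using (_⊎_)
open import Relation.Nullary using (¬_; does)
open import Relation.Binary.PropositionalEquality using (_≡_)

iter : {A : Set} → (A → A) → ℕ → A → A
iter f zero a = a
iter f (suc i) a = f (iter f i a)

module _ {n : ℕ} (adj : Fin n → Fin n → Bool) where
  reach≤ : ℕ → Fin n → Fin n → Bool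
  reach≤ zero u v = does (u ≟ v)
  reach≤ (suc m) u v = reach≤ m u v ∨ any (λ w → adj u w ∧ reach≤ m w v) (allFin n)

  -- shortest-path distance: the least m with a walk of length ≤ m
  -- (searching m = 0 .. n; the graphs used are connected, so the search never runs out)
  dist : Fin n → Fin n → ℕ
  dist u v = search n 0
    where
    search : ℕ → ℕ → ℕ
    search zero m = m
    search (suc f) m = if reach≤ m u v then m else search f (suc m)

  numEdges : ℕ
  numEdges = sum (map (λ u → sum (map (λ v → if adj u v ∧ (toℕ u <ᵇ toℕ v) then 1 else 0)
                                       (allFin n)))
                      (allFin n))

  -- rot u v : the neighbour of u following the neighbour v in the cyclic order
  -- of edges around u (rotation system).  The darts (u,v), (v,w), (w,u) form a
  -- triangular face; face tracing: the dart after (u,v) is (v, rot v u).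
  FaceTriangle : (Fin n → Fin n → Fin n) → Fin n → Fin n → Fin n → Set
  FaceTriangle rot u v w = T (adj u v) × T (adj v w) × T (adj w u)
                         × rot v u ≡ w × rot w v ≡ u × rot u w ≡ v

-- Maximal plane graphs on vertex set Fin n, given combinatorially as a
-- connected simple graph with a rotation system (combinatorial embedding)
-- of genus 0 (Euler's formula) all of whose faces are triangles.
record MaximalPlaneGraph (n : ℕ) : Set where
  field
    adj      : Fin n → Fin n → Bool
    irrefl   : ∀ u → adj u u ≡ false
    symm     : ∀ u v → adj u v ≡ adj v u
    rot        : Fin n → Fin n → Fin n
    rot-adj    : ∀ u v → T (adj u v) → T (adj u (rot u v))
    rot-inj    : ∀ u v w → T (adj u v) → T (adj u w) → rot u v ≡ rot u w → v ≡ w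
    rot-cyclic : ∀ u v w → T (adj u v) → T (adj u w) → ∃ λ i → iter (rot u) i v ≡ w
    three≤n    : 3 ≤ n
    connected  : ∀ u v → T (reach≤ adj n u v)
    triangular : ∀ u v → T (adj u v) → FaceTriangle adj rot u v (rot v u)
    -- Euler's formula V - E + F = 2 (sphere), which with triangular faces
    -- (2E = 3F) reads E = 3V - 6
    euler      : numEdges adj + 6 ≡ 3 * n

module _ {n : ℕ} (H : MaximalPlaneGraph n) where
  open MaximalPlaneGraph H using (adj; rot)

  d : Fin n → Fin n → ℕ
  d = dist adj

  IsFace : Fin n → Fin n → Fin n → Set
  IsFace x y z = FaceTriangle adj rot x y z ⊎ FaceTriangle adj rot x z y

  module _ (x y z : Fin n) where
    InQ : Fin n → Set
    InQ u = ∀ v → (d v x ≤ d u x) ⊎ (d v y ≤ d u y) ⊎ (d v z ≤ d u z)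

    minDist : Fin n → ℕ
    minDist u = d u x ⊓ d u y ⊓ d u z

    Layer : ℤ → List (Fin n) → List (Fin n) → Fin n → Set
    Layer k A B u = InQ u × (+ minDist u ≡ k)
                  × All (λ t → + d u t ≡ k) A
                  × All (λ t → + d u t ≡ k Data.Integer.+ + 1) B

    QuasiEcc : ℤ → Set
    QuasiEcc k = (Σ (Fin n) λ b → InQ b × ((+ d x b ≡ k) ⊎ (+ d y b ≡ k) ⊎ (+ d z b ≡ k)))
               × (∀ b → InQ b → All (λ a → k Data.Integer.≤ + d a b) (x ∷ y ∷ z ∷ []))

{-# OPTIONS --safe #-}
module Submission where

-- The face vertices x, y, z are pairwise adjacent, so the distances from any vertex w to
-- them differ by at most one: if one of them is k, all three are at most k + 1.  For w in Q,
-- the defining property of Q applied to u ∈ (k+1)_x^{y,z} gives d(w,x) ≥ d(u,x) = k + 1,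
-- since d(u,y) = d(u,z) = k + 2 exceed every distance from w; likewise v ∈ (k+1)_y^{x,z}
-- gives d(w,y) = k + 1.  So z is the only face vertex at distance k from such a w, which
-- empties every (k)_{s,t} and puts the vertex of Q realising q(H[f]) = k into (k)_z^{x,y}.

open import Defs
open import Data.Bool using (Bool; true; false; T; _∧_; if_then_else_)
open import Data.Bool.ListAction using (any)
open import Data.Bool.Properties using (T-∨; T-∧)
open import Data.Empty using (⊥-elim)
open import Data.Fin using (Fin; _≟_)
open import Data.Integer using (ℤ; _+_; +_; -[1+_]) renaming (_≤_ to _≤ℤ_)
open import Data.Integer.Properties using (+-injective; drop‿+≤+)
open import Data.List using ([]; _∷_; allFin)
open import Data.List.Membership.Propositional using (_∈_; lose)
open import Data.List.Membership.Propositional.Properties using (∈-allFin; ∈-++⁻)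
open import Data.List.Relation.Unary.All as All using (All; []; _∷_; tabulate; lookup)
open import Data.List.Relation.Unary.Any using (here; there; satisfied)
open import Data.List.Relation.Unary.Any.Properties using (any⁺; any⁻)
open import Data.Nat using (ℕ; zero; suc; _≤_; z≤n)
import Data.Nat as ℕ
import Data.Nat.Properties as ℕₚ
open import Data.Product using (∃; _×_; _,_)
open import Data.Sum using (_⊎_; inj₁; inj₂; [_,_]; map₂)
open import Function using (Equivalence)
open import Relation.Binary.PropositionalEquality using (_≡_; _≢_; refl; sym; trans; cong; subst)
open import Relation.Nullary using (¬_; yes; no)

open Equivalence using (to; from)

module Walks {n : ℕ} (adj : Fin n → Fin n → Bool) where

  reach≤-suc : ∀ m {u v} → T (reach≤ adj m u v) → T (reach≤ adj (suc m) u v)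
  reach≤-suc m r = from T-∨ (inj₁ r)

  reach≤-cons : ∀ m {u w v} → T (adj u w) → T (reach≤ adj m w v) → T (reach≤ adj (suc m) u v)
  reach≤-cons m {u} {w} {v} a r =
    from (T-∨ {reach≤ adj m u v}) (inj₂ (any⁺ (λ w′ → adj u w′ ∧ reach≤ adj m w′ v)
                                          (lose (∈-allFin w) (from T-∧ (a , r)))))

  reach≤-uncons : ∀ m {u v} → T (reach≤ adj (suc m) u v) →
                  T (reach≤ adj m u v) ⊎ ∃ λ w → T (adj u w) × T (reach≤ adj m w v)
  reach≤-uncons m {u} {v} r = map₂ first-step (to (T-∨ {reach≤ adj m u v}) r)
    where
    first-step : T (any (λ w → adj u w ∧ reach≤ adj m w v) (allFin n)) →
                 ∃ λ w → T (adj u w) × T (reach≤ adj m w v)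
    first-step p = let w , q = satisfied (any⁻ _ (allFin n) p) in w , to T-∧ q

  reach≤-zero : ∀ {u v} → T (reach≤ adj 0 u v) → u ≡ v
  reach≤-zero {u} {v} r with u ≟ v
  ... | yes u≡v = u≡v

  reach≤-refl : ∀ u → T (reach≤ adj 0 u u)
  reach≤-refl u with u ≟ u
  ... | yes _ = _
  ... | no u≢u = u≢u refl

  reach≤-snoc : ∀ m {u v w} → T (reach≤ adj m u v) → T (adj v w) → T (reach≤ adj (suc m) u w)
  reach≤-snoc zero {u} {v} {w} r a with reach≤-zero {u} {v} r
  ... | refl = reach≤-cons 0 a (reach≤-refl w)
  reach≤-snoc (suc m) r a with reach≤-uncons m r
  ... | inj₁ r′ = reach≤-suc (suc m) (reach≤-snoc m r′ a)
  ... | inj₂ (w , a′ , r′) = reach≤-cons (suc m) a′ (reach≤-snoc m r′ a)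

  module _ (adj-sym : ∀ {u v} → T (adj u v) → T (adj v u)) where

    reach≤-sym : ∀ m u v → T (reach≤ adj m u v) → T (reach≤ adj m v u)
    reach≤-sym zero u v r with reach≤-zero {u} {v} r
    ... | refl = reach≤-refl u
    reach≤-sym (suc m) u v r with reach≤-uncons m r
    ... | inj₁ r′ = reach≤-suc m (reach≤-sym m u v r′)
    ... | inj₂ (w , a , r′) = reach≤-snoc m (reach≤-sym m w v r′) (adj-sym a)

-- `dist` runs a search function local to its `where` block, which cannot be named
-- directly.  The meta `search` is solved to it: abstracting `suc n` and `1` in the
-- unfolded goal leaves the unification problem `search adj u v n m =?= <local> n m`
-- over distinct variables, which Agda solves.
mutual
  search : ∀ {n} → (Fin n → Fin n → Bool) → Fin n → Fin n → ℕ → ℕ → ℕ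
  search = _

  private
    dist-unfold : ∀ {n} (adj : Fin (suc n) → Fin (suc n) → Bool) u v →
                  dist adj u v ≡ (if reach≤ adj 0 u v then 0 else search adj u v n 1)
    dist-unfold {n} with suc n | 1
    ... | _ | _ = λ adj u v → refl

dist≡search : ∀ {n} (adj : Fin n → Fin n → Bool) u v → dist adj u v ≡ search adj u v n 0
dist≡search {zero}  adj () v
dist≡search {suc _} adj u v = dist-unfold adj u v

module _ {n : ℕ} (adj : Fin n → Fin n → Bool) (u v : Fin n) where

  search-≤ : ∀ f {m m′} → m ≤ m′ → T (reach≤ adj m′ u v) → search adj u v f m ≤ m′
  search-≤ zero    m≤m′ r = m≤m′
  search-≤ (suc f) {m} m≤m′ r with reach≤ adj m u v in e
  ... | true  = m≤m′
  ... | false = search-≤ f (ℕₚ.≤∧≢⇒< m≤m′ λ { refl → subst T e r }) r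

  search-reaches : ∀ f m → T (reach≤ adj (m ℕ.+ f) u v) → T (reach≤ adj (search adj u v f m) u v)
  search-reaches zero    m r = subst (λ j → T (reach≤ adj j u v)) (ℕₚ.+-identityʳ m) r
  search-reaches (suc f) m r with reach≤ adj m u v in e
  ... | true  = subst T (sym e) _
  ... | false = search-reaches f (suc m) (subst (λ j → T (reach≤ adj j u v)) (ℕₚ.+-suc m f) r)

  dist-≤ : ∀ {m} → T (reach≤ adj m u v) → dist adj u v ≤ m
  dist-≤ r rewrite dist≡search adj u v = search-≤ n z≤n r

  dist-reaches : T (reach≤ adj n u v) → T (reach≤ adj (dist adj u v) u v)
  dist-reaches r rewrite dist≡search adj u v = search-reaches n 0 r

module _ {n : ℕ} (H : MaximalPlaneGraph n) where
  open MaximalPlaneGraph H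
  open Walks adj

  adj-sym : ∀ {u v} → T (adj u v) → T (adj v u)
  adj-sym {u} {v} = subst T (symm u v)

  d-reaches : ∀ u v → T (reach≤ adj (d H u v) u v)
  d-reaches u v = dist-reaches adj u v (connected u v)

  d-sym : ∀ u v → d H u v ≡ d H v u
  d-sym u v = ℕₚ.≤-antisym (dist-≤ adj u v (reach≤-sym adj-sym (d H v u) v u (d-reaches v u)))
                           (dist-≤ adj v u (reach≤-sym adj-sym (d H u v) u v (d-reaches u v)))

  d-adjacent : ∀ w {s t} → T (adj s t) → d H w t ≤ suc (d H w s)
  d-adjacent w {s} a = dist-≤ adj w _ (reach≤-snoc (d H w s) (d-reaches w s) a)

  face-triangle : ∀ {x y z} → IsFace H x y z → T (adj x y) × T (adj y z) × T (adj z x)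
  face-triangle (inj₁ (xy , yz , zx , _)) = xy , yz , zx
  face-triangle (inj₂ (xz , zy , yx , _)) = adj-sym yx , adj-sym zy , adj-sym xz

  triangle-adjacent : ∀ {x y z} → T (adj x y) × T (adj y z) × T (adj z x) → ∀ {s t} →
                      s ∈ x ∷ y ∷ z ∷ [] → t ∈ x ∷ y ∷ z ∷ [] → s ≡ t ⊎ T (adj s t)
  triangle-adjacent (xy , yz , zx) = λ where
    (here refl)                 (here refl)                 → inj₁ refl
    (here refl)                 (there (here refl))         → inj₂ xy
    (here refl)                 (there (there (here refl))) → inj₂ (adj-sym zx)
    (there (here refl))         (here refl)                 → inj₂ (adj-sym xy)
    (there (here refl))         (there (here refl))         → inj₁ refl
    (there (here refl))         (there (there (here refl))) → inj₂ yz
    (there (there (here refl))) (here refl)                 → inj₂ zx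
    (there (there (here refl))) (there (here refl))         → inj₂ (adj-sym yz)
    (there (there (here refl))) (there (there (here refl))) → inj₁ refl

  face-close : ∀ {x y z} → IsFace H x y z → ∀ w {s t} →
               s ∈ x ∷ y ∷ z ∷ [] → t ∈ x ∷ y ∷ z ∷ [] → d H w t ≤ suc (d H w s)
  face-close face w s∈ t∈ with triangle-adjacent (face-triangle face) s∈ t∈
  ... | inj₁ refl = ℕₚ.n≤1+n _
  ... | inj₂ a    = d-adjacent w a

  face-dists-≤-suc : ∀ {x y z} → IsFace H x y z → ∀ w {s K} → s ∈ x ∷ y ∷ z ∷ [] → d H w s ≡ K →
                     All (λ t → d H w t ≤ suc K) (x ∷ y ∷ z ∷ [])
  face-dists-≤-suc face w s∈ refl = tabulate (face-close face w s∈)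

+-+1≡+suc : ∀ m → + m + + 1 ≡ + suc m
+-+1≡+suc m = cong +_ (ℕₚ.+-comm m 1)

module _ {n : ℕ} (H : MaximalPlaneGraph n) {x y z : Fin n} where

  layer-suc-distances : ∀ {K s t t′ u} → Layer H x y z (+ K + + 1) (s ∷ []) (t ∷ t′ ∷ []) u →
                        d H u s ≡ suc K × d H u t ≡ suc (suc K) × d H u t′ ≡ suc (suc K)
  layer-suc-distances {K} (_ , _ , (ds ∷ []) , (dt ∷ dt′ ∷ [])) = at-1 ds , at-2 dt , at-2 dt′
    where
    at-1 : ∀ {a} → + a ≡ + K + + 1 → a ≡ suc K
    at-1 e = +-injective (trans e (+-+1≡+suc K))
    at-2 : ∀ {a} → + a ≡ + K + + 1 + + 1 → a ≡ suc (suc K)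
    at-2 e = +-injective (trans e (trans (cong (_+ + 1) (+-+1≡+suc K)) (+-+1≡+suc (suc K))))

  attained-at : ∀ {K b} → (+ d H x b ≡ + K) ⊎ (+ d H y b ≡ + K) ⊎ (+ d H z b ≡ + K) →
                ∃ λ a → a ∈ x ∷ y ∷ z ∷ [] × d H b a ≡ K
  attained-at {K} {b} =
    [ at (here refl) , [ at (there (here refl)) , at (there (there (here refl))) ] ]
    where
    at : ∀ {a} → a ∈ x ∷ y ∷ z ∷ [] → + d H a b ≡ + K → ∃ λ a → a ∈ x ∷ y ∷ z ∷ [] × d H b a ≡ K
    at {a} a∈ e = a , a∈ , trans (d-sym H b a) (+-injective e)

module _ {n : ℕ} (H : MaximalPlaneGraph n) {x y z : Fin n} (face : IsFace H x y z)
         {K : ℕ} {u v : Fin n}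
         (u∈ : Layer H x y z (+ K + + 1) (x ∷ []) (y ∷ z ∷ []) u)
         (v∈ : Layer H x y z (+ K + + 1) (y ∷ []) (x ∷ z ∷ []) v) where

  xy-at-suc-level : ∀ {w} → InQ H x y z w → All (λ t → d H w t ≤ suc K) (x ∷ y ∷ z ∷ []) →
                    All (λ t → d H w t ≡ suc K) (x ∷ y ∷ [])
  xy-at-suc-level w∈Q (wx ∷ wy ∷ wz ∷ [])
    with layer-suc-distances H u∈ | layer-suc-distances H v∈
  ... | ux , uy , uz | vy , vx , vz =
      [ reaches ux wx , [ misses uy wy , misses uz wz ] ] (w∈Q u)
    ∷ [ misses vx wx , [ reaches vy wy , misses vz wz ] ] (w∈Q v)
    ∷ []
    where
    reaches : ∀ {a b} → a ≡ suc K → b ≤ suc K → a ≤ b → b ≡ suc K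
    reaches refl b≤ a≤ = ℕₚ.≤-antisym b≤ a≤
    misses : ∀ {a b} {A : Set} → a ≡ suc (suc K) → b ≤ suc K → a ≤ b → A
    misses refl b≤ a≤ = ⊥-elim (ℕₚ.≤⇒≯ b≤ a≤)

  xy-not-at-level : ∀ {w s t} → InQ H x y z w → s ∈ x ∷ y ∷ z ∷ [] → d H w s ≡ K →
                    t ∈ x ∷ y ∷ [] → d H w t ≢ K
  xy-not-at-level {w} w∈Q s∈ ds t∈ dt =
    ℕₚ.1+n≢n (trans (sym (lookup (xy-at-suc-level w∈Q (face-dists-≤-suc H face w s∈ ds)) t∈)) dt)

  layer-pair-empty : ∀ s t → s ∈ x ∷ y ∷ z ∷ [] → t ∈ x ∷ y ∷ z ∷ [] → s ≢ t →
                     ∀ w → ¬ Layer H x y z (+ K) (s ∷ t ∷ []) [] w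
  layer-pair-empty s t s∈ t∈ s≢t w (w∈Q , _ , (ds ∷ dt ∷ []) , [])
    with +-injective ds | ∈-++⁻ (x ∷ y ∷ []) s∈ | ∈-++⁻ (x ∷ y ∷ []) t∈
  ... | ws | inj₁ s∈xy        | _                = xy-not-at-level w∈Q s∈ ws s∈xy ws
  ... | ws | inj₂ _           | inj₁ t∈xy        = xy-not-at-level w∈Q s∈ ws t∈xy (+-injective dt)
  ... | _  | inj₂ (here refl) | inj₂ (here refl) = s≢t refl

  layer-z-nonempty : QuasiEcc H x y z (+ K) → ∃ (Layer H x y z (+ K) (z ∷ []) (x ∷ y ∷ []))
  layer-z-nonempty ((b , b∈Q , attained) , lower) with attained-at H attained | lower b b∈Q
  ... | a , a∈ , ba | Kx ∷ Ky ∷ _ with ∈-++⁻ (x ∷ y ∷ []) a∈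
  ...   | inj₁ a∈xy        = ⊥-elim (xy-not-at-level b∈Q a∈ ba a∈xy ba)
  ...   | inj₂ (here refl) =
    b , b∈Q , cong +_ minDist≡K , (cong +_ ba ∷ [])
      , All.map at-suc (xy-at-suc-level b∈Q (face-dists-≤-suc H face b a∈ ba))
    where
    K≤ : ∀ {t} → + K ≤ℤ + d H t b → K ≤ d H b t
    K≤ {t} le = subst (K ≤_) (d-sym H t b) (drop‿+≤+ le)
    minDist≡K : minDist H x y z b ≡ K
    minDist≡K = trans (ℕₚ.m≥n⇒m⊓n≡n (subst (_≤ _) (sym ba) (ℕₚ.⊓-glb (K≤ Kx) (K≤ Ky)))) ba
    at-suc : ∀ {a} → a ≡ suc K → + a ≡ + K + + 1
    at-suc e = trans (cong +_ e) (sym (+-+1≡+suc K))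

corollary14 : ∀ {n} (H : MaximalPlaneGraph n) (x y z : Fin n) → IsFace H x y z → (k : ℤ)
    → ∃ (Layer H x y z (k + + 1) (x ∷ []) (y ∷ z ∷ []))
    → ∃ (Layer H x y z (k + + 1) (y ∷ []) (x ∷ z ∷ []))
    → (∀ s t → s ∈ x ∷ y ∷ z ∷ [] → t ∈ x ∷ y ∷ z ∷ [] → s ≢ t
         → ∀ u → ¬ Layer H x y z k (s ∷ t ∷ []) [] u)
      × (QuasiEcc H x y z k → ∃ (Layer H x y z k (z ∷ []) (x ∷ y ∷ [])))
corollary14 H x y z face -[1+ _ ] _ _ =
    (λ { _ _ _ _ _ _ (_ , _ , (() ∷ _) , _) })
  , λ { ((_ , _ , inj₁ ()) , _) ; ((_ , _ , inj₂ (inj₁ ())) , _) ; ((_ , _ , inj₂ (inj₂ ())) , _) }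
corollary14 H x y z face (+ K) (_ , u∈) (_ , v∈) =
  layer-pair-empty H face u∈ v∈ , layer-z-nonempty H face u∈ v∈
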